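{- Let $p(X)=X^3+X^2-X+1$ and $p^*(X)=X^3p(1/X)=X^3-X^2+X+1$. Every Borwein polynomial of degree at most $2$ with no real roots in $[0,\infty)$ divides some Newman polynomial, and the set of Borwein polynomials of degree at most $3$ with no real roots in $[0,\infty)$ that divide no Newman polynomial is exactly $\{p(X),-p(X),p^*(X),-p^*(X)\}$.
   Context: A polynomial $P(X)=a_dX^d+\dots+a_0\in\mathbb{Z}[X]$ is a Borwein polynomial if all $a_j\in\{ -1,0,1\}$, $a_d\ne0$ and $a_0\neq0$. It is a Newman polynomial if all $a_j\in\{0,1\}$, $a_d\ne 0$ and $a_0=1$. "Divides" means divisibility in $\mathbb{Z}[X]$. -}

module Defs where

open import Data.Nat as ℕ using (ℕ; zero; suc)
open import Data.Integer as ℤ using (ℤ; +_; -[1+_])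
open import Data.Rational as ℚ using (ℚ)
open import Data.List using (List; []; _∷_; length; map; last)
open import Data.Maybe using (just)
open import Data.List.Relation.Unary.All using (All)
open import Data.Product using (Σ; ∃; _×_)
open import Data.Sum using (_⊎_)
open import Relation.Binary.PropositionalEquality using (_≡_; _≢_)
open import Relation.Nullary using (¬_)
open import Data.Empty using (⊥)

-- Polynomials in ℤ[X] as coefficient lists, constant term first:
-- a₀ ∷ a₁ ∷ … ∷ a_d ∷ [] represents a₀ + a₁ X + … + a_d X^d.
Poly : Set
Poly = List ℤ

coeff : Poly → ℕ → ℤ
coeff []       _       = + 0
coeff (a ∷ _)  zero    = a
coeff (_ ∷ p)  (suc k) = coeff p k

_+ₚ_ : Poly → Poly → Poly
[]      +ₚ q       = q
(a ∷ p) +ₚ []      = a ∷ p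
(a ∷ p) +ₚ (b ∷ q) = (a ℤ.+ b) ∷ (p +ₚ q)

_*ₚ_ : Poly → Poly → Poly
[]      *ₚ q = []
(a ∷ p) *ₚ q = map (a ℤ.*_) q +ₚ (+ 0 ∷ (p *ₚ q))

-- equality in ℤ[X]: all coefficients agree (ignores trailing zeros)
_≈ₚ_ : Poly → Poly → Set
p ≈ₚ q = ∀ k → coeff p k ≡ coeff q k

_∣ₚ_ : Poly → Poly → Set
p ∣ₚ n = ∃ λ (q : Poly) → (p *ₚ q) ≈ₚ n

data Trit : ℤ → Set where
  t-1 : Trit -[1+ 0 ]
  t0  : Trit (+ 0)
  t1  : Trit (+ 1)

data Bit : ℤ → Set where
  b0 : Bit (+ 0)
  b1 : Bit (+ 1)

Borwein : Poly → Set
Borwein []      = ⊥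
Borwein (a ∷ p) = All Trit (a ∷ p) × a ≢ + 0 × ∃ λ ad → last (a ∷ p) ≡ just ad × ad ≢ + 0

Newman : Poly → Set
Newman []      = ⊥
Newman (a ∷ p) = All Bit (a ∷ p) × a ≡ + 1 × ∃ λ ad → last (a ∷ p) ≡ just ad × ad ≢ + 0

DividesSomeNewman : Poly → Set
DividesSomeNewman p = ∃ λ n → Newman n × p ∣ₚ n

-- degree at most d, for a polynomial with nonzero leading coefficient
-- given as its (normalised) coefficient list
DegAtMost : ℕ → Poly → Set
DegAtMost d p = length p ℕ.≤ suc d

evalℚ : Poly → ℚ → ℚ
evalℚ []      x = ℚ.0ℚ
evalℚ (a ∷ p) x = (a ℚ./ 1) ℚ.+ x ℚ.* evalℚ p x

-- Real numbers are represented as regular Cauchy sequences of rationals: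
-- s with |s m - s n| ≤ 1/(m+1) + 1/(n+1).  A real x = lim s is ≥ 0 iff it is
-- the limit of such a sequence of nonnegative rationals, and P(x) = 0 iff
-- P(s n) → 0 (P is continuous).
IsRegularCauchy : (ℕ → ℚ) → Set
IsRegularCauchy s = ∀ m n →
  ℚ.∣ s m ℚ.- s n ∣ ℚ.≤ ((+ 1) ℚ./ suc m) ℚ.+ ((+ 1) ℚ./ suc n)

HasNonnegRealRoot : Poly → Set
HasNonnegRealRoot p = ∃ λ (s : ℕ → ℚ) →
  IsRegularCauchy s ×
  (∀ n → ℚ.0ℚ ℚ.≤ s n) ×
  (∀ k → ∃ λ N → ∀ n → N ℕ.≤ n → ℚ.∣ evalℚ p (s n) ∣ ℚ.≤ ((+ 1) ℚ./ suc k))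

pPoly : Poly
pPoly = + 1 ∷ -[1+ 0 ] ∷ + 1 ∷ + 1 ∷ []

pStar : Poly
pStar = + 1 ∷ + 1 ∷ -[1+ 0 ] ∷ + 1 ∷ []

negₚ : Poly → Poly
negₚ = map (λ a → ℤ.- a)

-- Work in ℤ[Y]/(p) ≅ ℤ³ with basis 1, Y, Y².  If p divides a Newman polynomial n then n(Y) = 0
-- there; but Horner's rule, started at the leading coefficient 1 and fed the digits 0 and 1,
-- keeps its value in a region (two opposite cones and eight points) that avoids 0.  Since
-- ℤ[X]/(p*) is the same ring with X = Y⁻¹, multiples of p* are handled by the same recursion
-- run from the constant term.  On [0, ∞) both p and p* are a sum of nonnegative terms and a
-- constant ≥ ¾, so ±p and ±p* have no roots there.  Up to sign, every other Borwein
-- polynomial of degree at most 3 either has an explicit Newman multiple or changes sign on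
-- [0, 1] or [1, 2], where bisection produces a regular Cauchy sequence of approximate roots.

module Submission where

open import Defs
open import Data.Empty using (⊥-elim)
open import Data.Integer as ℤ using (ℤ; +_; -[1+_]; 0ℤ; 1ℤ; -1ℤ; +≤+)
import Data.Integer.Properties as ℤP
open import Data.Integer.Tactic.RingSolver using (solve)
open import Data.List using ([]; _∷_; map; last; length)
open import Data.List.Properties using (map-∘; map-cong; map-id; last-map; length-map)
open import Data.Maybe as Maybe using (just; nothing)
open import Data.Maybe.Properties using (just-injective)
open import Data.Nat as ℕ using (ℕ; zero; suc; s≤s)
import Data.Nat.Properties as ℕP
open import Data.Nat.Tactic.RingSolver using (solve-∀)
open import Data.Product using (∃; _×_; _,_; proj₁; proj₂)
open import Data.Rational as ℚ using (ℚ; ½; 0ℚ; 1ℚ; _≤_; _+_; _*_; _-_; -_; ∣_∣)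
import Data.Rational.Properties as ℚP
open import Data.Rational.Solver using (module +-*-Solver)
open import Data.Rational.Unnormalised as ℚᵘ using (mkℚᵘ)
import Data.Rational.Unnormalised.Properties as ℚᵘP
open import Data.Sum as Sum using (_⊎_; inj₁; inj₂)
open import Function using (_∘_)
open import Function.Bundles using (_⇔_; mk⇔)
open import Relation.Binary.PropositionalEquality
open import Relation.Nullary using (¬_; Dec; yes; no; _×-dec_)
open import Relation.Nullary.Decidable using (True; toWitness)

open +-*-Solver using (_:+_; _:*_; _:-_; :-_; _:=_; con) renaming (solve to solveℚ)

-- Evaluating polynomials at linear maps of ℤ³

data V³ : Set where
  ⟨_,_,_⟩ : ℤ → ℤ → ℤ → V³

infixr 5 _+ᶜ_
infixl 6 _⊕_
infix 7 _·_

_⊕_ : V³ → V³ → V³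
⟨ a , b , c ⟩ ⊕ ⟨ a′ , b′ , c′ ⟩ = ⟨ a ℤ.+ a′ , b ℤ.+ b′ , c ℤ.+ c′ ⟩

_·_ : ℤ → V³ → V³
k · ⟨ a , b , c ⟩ = ⟨ k ℤ.* a , k ℤ.* b , k ℤ.* c ⟩

⊖_ : V³ → V³
⊖ ⟨ a , b , c ⟩ = ⟨ ℤ.- a , ℤ.- b , ℤ.- c ⟩

_+ᶜ_ : ℤ → V³ → V³
n +ᶜ ⟨ a , b , c ⟩ = ⟨ n ℤ.+ a , b , c ⟩

0v : V³
0v = ⟨ 0ℤ , 0ℤ , 0ℤ ⟩

⟨⟩-cong : ∀ {a b c a′ b′ c′} → a ≡ a′ → b ≡ b′ → c ≡ c′ → ⟨ a , b , c ⟩ ≡ ⟨ a′ , b′ , c′ ⟩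
⟨⟩-cong refl refl refl = refl

⊕-identityˡ : ∀ v → 0v ⊕ v ≡ v
⊕-identityˡ ⟨ a , b , c ⟩ = ⟨⟩-cong (ℤP.+-identityˡ a) (ℤP.+-identityˡ b) (ℤP.+-identityˡ c)

⊕-identityʳ : ∀ v → v ⊕ 0v ≡ v
⊕-identityʳ ⟨ a , b , c ⟩ = ⟨⟩-cong (ℤP.+-identityʳ a) (ℤP.+-identityʳ b) (ℤP.+-identityʳ c)

+ᶜ-⊕-interchange : ∀ m n u v → (m ℤ.+ n) +ᶜ (u ⊕ v) ≡ (m +ᶜ u) ⊕ (n +ᶜ v)
+ᶜ-⊕-interchange m n ⟨ a , b , c ⟩ ⟨ a′ , b′ , c′ ⟩ =
  ⟨⟩-cong (solve (m ∷ n ∷ a ∷ a′ ∷ [])) refl refl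

·-distrib-+ᶜ : ∀ k n v → (k ℤ.* n) +ᶜ k · v ≡ k · (n +ᶜ v)
·-distrib-+ᶜ k n ⟨ a , b , c ⟩ = ⟨⟩-cong (solve (k ∷ n ∷ a ∷ [])) refl refl

·-zeroʳ : ∀ k → k · 0v ≡ 0v
·-zeroʳ k = ⟨⟩-cong (ℤP.*-zeroʳ k) (ℤP.*-zeroʳ k) (ℤP.*-zeroʳ k)

neg-· : ∀ k v → ℤ.- k · v ≡ k · ⊖ v
neg-· k ⟨ a , b , c ⟩ = ⟨⟩-cong (solve (k ∷ a ∷ [])) (solve (k ∷ b ∷ [])) (solve (k ∷ c ∷ []))

record IsLinear (M : V³ → V³) : Set where
  field
    ⊕-homo : ∀ u v → M (u ⊕ v) ≡ M u ⊕ M v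
    ·-homo : ∀ k v → M (k · v) ≡ k · M v

  0-homo : M 0v ≡ 0v
  0-homo = begin
    M 0v            ≡⟨ cong M (sym (·-zeroʳ 0ℤ)) ⟩
    M (0ℤ · 0v)     ≡⟨ ·-homo 0ℤ 0v ⟩
    0ℤ · M 0v       ≡⟨ zero-· (M 0v) ⟩
    0v              ∎
    where
    open ≡-Reasoning
    zero-· : ∀ v → 0ℤ · v ≡ 0v
    zero-· ⟨ a , b , c ⟩ = refl

-- act M f v = f(M) v and ev M f = f(M) ⟨ 1 , 0 , 0 ⟩.
act : (V³ → V³) → Poly → V³ → V³
act M []      v = 0v
act M (a ∷ f) v = a · v ⊕ M (act M f v)

ev : (V³ → V³) → Poly → V³
ev M []      = 0v
ev M (a ∷ f) = a +ᶜ M (ev M f)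

Annihilates : Poly → (V³ → V³) → Set
Annihilates f M = ∀ a b c → act M f ⟨ a , b , c ⟩ ≡ 0v

act-negₚ : ∀ M f v → act M (negₚ f) v ≡ act M f (⊖ v)
act-negₚ M []      v = refl
act-negₚ M (a ∷ f) v = cong₂ (λ u w → u ⊕ M w) (neg-· a v) (act-negₚ M f v)

annihilates-negₚ : ∀ f M → Annihilates f M → Annihilates (negₚ f) M
annihilates-negₚ f M ann a b c =
  trans (act-negₚ M f ⟨ a , b , c ⟩) (ann (ℤ.- a) (ℤ.- b) (ℤ.- c))

negₚ-involutive : ∀ P → negₚ (negₚ P) ≡ P
negₚ-involutive P = trans (sym (map-∘ P)) (trans (map-cong ℤP.neg-involutive P) (map-id P))

negₚ-*ₚ-negₚ : ∀ P q → negₚ P *ₚ negₚ q ≡ P *ₚ q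
negₚ-*ₚ-negₚ []      q = refl
negₚ-*ₚ-negₚ (a ∷ P) q = cong₂ (λ r s → r +ₚ (0ℤ ∷ s))
  (trans (sym (map-∘ q)) (map-cong neg*neg q))
  (negₚ-*ₚ-negₚ P q)
  where
  neg*neg : ∀ b → ℤ.- a ℤ.* ℤ.- b ≡ a ℤ.* b
  neg*neg b = solve (a ∷ b ∷ [])

module _ {M : V³ → V³} (linear : IsLinear M) where
  open IsLinear linear
  open ≡-Reasoning

  ev-+ₚ : ∀ f g → ev M (f +ₚ g) ≡ ev M f ⊕ ev M g
  ev-+ₚ []      g       = sym (⊕-identityˡ (ev M g))
  ev-+ₚ (a ∷ f) []      = sym (⊕-identityʳ (ev M (a ∷ f)))
  ev-+ₚ (a ∷ f) (b ∷ g) = begin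
    (a ℤ.+ b) +ᶜ M (ev M (f +ₚ g))          ≡⟨ cong (λ w → (a ℤ.+ b) +ᶜ M w) (ev-+ₚ f g) ⟩
    (a ℤ.+ b) +ᶜ M (ev M f ⊕ ev M g)        ≡⟨ cong ((a ℤ.+ b) +ᶜ_) (⊕-homo (ev M f) (ev M g)) ⟩
    (a ℤ.+ b) +ᶜ (M (ev M f) ⊕ M (ev M g))  ≡⟨ +ᶜ-⊕-interchange a b (M (ev M f)) (M (ev M g)) ⟩
    ev M (a ∷ f) ⊕ ev M (b ∷ g)             ∎

  ev-scale : ∀ k g → ev M (map (k ℤ.*_) g) ≡ k · ev M g
  ev-scale k []      = sym (·-zeroʳ k)
  ev-scale k (a ∷ g) = begin
    (k ℤ.* a) +ᶜ M (ev M (map (k ℤ.*_) g))  ≡⟨ cong (λ w → (k ℤ.* a) +ᶜ M w) (ev-scale k g) ⟩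
    (k ℤ.* a) +ᶜ M (k · ev M g)             ≡⟨ cong ((k ℤ.* a) +ᶜ_) (·-homo k (ev M g)) ⟩
    (k ℤ.* a) +ᶜ k · M (ev M g)             ≡⟨ ·-distrib-+ᶜ k a (M (ev M g)) ⟩
    k · ev M (a ∷ g)                        ∎

  ev-*ₚ : ∀ f g → ev M (f *ₚ g) ≡ act M f (ev M g)
  ev-*ₚ []      g = refl
  ev-*ₚ (a ∷ f) g = begin
    ev M (map (a ℤ.*_) g +ₚ (0ℤ ∷ f *ₚ g))    ≡⟨ ev-+ₚ (map (a ℤ.*_) g) (0ℤ ∷ f *ₚ g) ⟩
    ev M (map (a ℤ.*_) g) ⊕ ev M (0ℤ ∷ f *ₚ g) ≡⟨ cong₂ _⊕_ (ev-scale a g) (zero-+ᶜ (M (ev M (f *ₚ g)))) ⟩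
    a · ev M g ⊕ M (ev M (f *ₚ g))             ≡⟨ cong (λ w → a · ev M g ⊕ M w) (ev-*ₚ f g) ⟩
    act M (a ∷ f) (ev M g)                     ∎
    where
    zero-+ᶜ : ∀ v → 0ℤ +ᶜ v ≡ v
    zero-+ᶜ ⟨ a , b , c ⟩ = cong (λ x → ⟨ x , b , c ⟩) (ℤP.+-identityˡ a)

  ev-zero : ∀ f → (∀ k → coeff f k ≡ 0ℤ) → ev M f ≡ 0v
  ev-zero []      _  = refl
  ev-zero (a ∷ f) f≈0 rewrite f≈0 0 | ev-zero f (λ k → f≈0 (suc k)) | 0-homo = refl

  ev-≈ₚ : ∀ f g → f ≈ₚ g → ev M f ≡ ev M g
  ev-≈ₚ []      g       f≈g = sym (ev-zero g (λ k → sym (f≈g k)))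
  ev-≈ₚ (a ∷ f) []      f≈g = ev-zero (a ∷ f) f≈g
  ev-≈ₚ (a ∷ f) (b ∷ g) f≈g = cong₂ (λ x w → x +ᶜ M w) (f≈g 0) (ev-≈ₚ f g (λ k → f≈g (suc k)))

  ∣ₚ⇒ev≡0 : ∀ f n → Annihilates f M → f ∣ₚ n → ev M n ≡ 0v
  ∣ₚ⇒ev≡0 f n ann (q , fq≈n) = begin
    ev M n            ≡⟨ ev-≈ₚ (f *ₚ q) n fq≈n ⟨
    ev M (f *ₚ q)     ≡⟨ ev-*ₚ f q ⟩
    act M f (ev M q)  ≡⟨ annihilated (ev M q) ⟩
    0v                ∎
    where
    annihilated : ∀ v → act M f v ≡ 0v
    annihilated ⟨ a , b , c ⟩ = ann a b c

-- Multiples of p and p* are not Newman polynomials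

-- ℤ³ is ℤ[Y]/(p) in the basis 1, Y, Y²: mulY is multiplication by Y (Y³ = Y - Y² - 1)
-- and mulY⁻¹ is its inverse.  Since p*(Y⁻¹) = Y⁻³ p(Y), p* annihilates mulY⁻¹.
mulY : V³ → V³
mulY ⟨ a , b , c ⟩ = ⟨ ℤ.- c , a ℤ.+ c , b ℤ.- c ⟩

mulY⁻¹ : V³ → V³
mulY⁻¹ ⟨ a , b , c ⟩ = ⟨ a ℤ.+ b , c ℤ.- a , ℤ.- a ⟩

mulY-linear : IsLinear mulY
mulY-linear = record { ⊕-homo = ⊕-homo ; ·-homo = ·-homo }
  where
  ⊕-homo : ∀ u v → mulY (u ⊕ v) ≡ mulY u ⊕ mulY v
  ⊕-homo ⟨ a , b , c ⟩ ⟨ a′ , b′ , c′ ⟩ =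
    ⟨⟩-cong (solve (c ∷ c′ ∷ [])) (solve (a ∷ c ∷ a′ ∷ c′ ∷ [])) (solve (b ∷ c ∷ b′ ∷ c′ ∷ []))
  ·-homo : ∀ k v → mulY (k · v) ≡ k · mulY v
  ·-homo k ⟨ a , b , c ⟩ =
    ⟨⟩-cong (solve (k ∷ c ∷ [])) (solve (k ∷ a ∷ c ∷ [])) (solve (k ∷ b ∷ c ∷ []))

mulY⁻¹-linear : IsLinear mulY⁻¹
mulY⁻¹-linear = record { ⊕-homo = ⊕-homo ; ·-homo = ·-homo }
  where
  ⊕-homo : ∀ u v → mulY⁻¹ (u ⊕ v) ≡ mulY⁻¹ u ⊕ mulY⁻¹ v
  ⊕-homo ⟨ a , b , c ⟩ ⟨ a′ , b′ , c′ ⟩ =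
    ⟨⟩-cong (solve (a ∷ b ∷ a′ ∷ b′ ∷ [])) (solve (a ∷ c ∷ a′ ∷ c′ ∷ [])) (solve (a ∷ a′ ∷ []))
  ·-homo : ∀ k v → mulY⁻¹ (k · v) ≡ k · mulY⁻¹ v
  ·-homo k ⟨ a , b , c ⟩ =
    ⟨⟩-cong (solve (k ∷ a ∷ b ∷ [])) (solve (k ∷ a ∷ c ∷ [])) (solve (k ∷ a ∷ []))

p-annihilates-mulY : Annihilates pPoly mulY
p-annihilates-mulY a b c =
  ⟨⟩-cong (solve (a ∷ b ∷ c ∷ [])) (solve (a ∷ b ∷ c ∷ [])) (solve (a ∷ b ∷ c ∷ []))

p*-annihilates-mulY⁻¹ : Annihilates pStar mulY⁻¹
p*-annihilates-mulY⁻¹ a b c =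
  ⟨⟩-cong (solve (a ∷ b ∷ c ∷ [])) (solve (a ∷ b ∷ c ∷ [])) (solve (a ∷ b ∷ c ∷ []))

unstep : ℤ → V³ → V³
unstep n u = mulY (ℤ.- n +ᶜ u)

unstep-inverse : ∀ n v → unstep n (n +ᶜ mulY⁻¹ v) ≡ v
unstep-inverse n ⟨ a , b , c ⟩ =
  ⟨⟩-cong (solve (n ∷ a ∷ [])) (solve (n ∷ a ∷ b ∷ [])) (solve (a ∷ c ∷ []))

unstep-⊖mulY : ∀ n v → unstep n (⊖ mulY v) ≡ ⊖ mulY (n +ᶜ mulY v)
unstep-⊖mulY n ⟨ a , b , c ⟩ =
  ⟨⟩-cong (solve (n ∷ b ∷ c ∷ [])) (solve (n ∷ b ∷ c ∷ [])) (solve (a ∷ b ∷ c ∷ []))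

⊖mulY-injective : ∀ v → ⊖ mulY v ≡ 0v → v ≡ 0v
⊖mulY-injective v eq = trans (sym (cancel v)) (cong (λ w → ⊖ mulY⁻¹ w) eq)
  where
  cancel : ∀ v → ⊖ mulY⁻¹ (⊖ mulY v) ≡ v
  cancel ⟨ a , b , c ⟩ = ⟨⟩-cong (solve (a ∷ c ∷ [])) (solve (b ∷ c ∷ [])) (solve (c ∷ []))

open import Data.List.Relation.Unary.All as All using (All; []; _∷_; all?)
import Data.List.Relation.Unary.All.Properties as AllP

decide-≤ℤ : ∀ {i j} {i≤j : True (i ℤ.≤? j)} → i ℤ.≤ j
decide-≤ℤ {i≤j = i≤j} = toWitness i≤j

bit-≥0 : ∀ {n} → Bit n → 0ℤ ℤ.≤ n
bit-≥0 b0 = decide-≤ℤ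
bit-≥0 b1 = decide-≤ℤ

bit-≤1 : ∀ {n} → Bit n → n ℤ.≤ 1ℤ
bit-≤1 b0 = decide-≤ℤ
bit-≤1 b1 = decide-≤ℤ

-- Two opposite cones, and the points that the orbit of ⟨ 1 , 0 , 0 ⟩ visits before entering them.
data Trapped : V³ → Set where
  cone⁺ : ∀ {a b c} → 0ℤ ℤ.≤ a → b ℤ.≤ 0ℤ → 1ℤ ℤ.≤ c → Trapped ⟨ a , b , c ⟩
  cone⁻ : ∀ {a b c} → a ℤ.≤ 0ℤ → 0ℤ ℤ.≤ b → c ℤ.≤ -1ℤ → Trapped ⟨ a , b , c ⟩
  ⟨-1,1,0⟩ : Trapped ⟨ -1ℤ , 1ℤ , 0ℤ ⟩
  ⟨-1,2,0⟩ : Trapped ⟨ -1ℤ , + 2 , 0ℤ ⟩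
  ⟨0,1,0⟩  : Trapped ⟨ 0ℤ , 1ℤ , 0ℤ ⟩
  ⟨0,1,1⟩  : Trapped ⟨ 0ℤ , 1ℤ , 1ℤ ⟩
  ⟨0,2,0⟩  : Trapped ⟨ 0ℤ , + 2 , 0ℤ ⟩
  ⟨1,0,0⟩  : Trapped ⟨ 1ℤ , 0ℤ , 0ℤ ⟩
  ⟨1,1,0⟩  : Trapped ⟨ 1ℤ , 1ℤ , 0ℤ ⟩
  ⟨1,1,1⟩  : Trapped ⟨ 1ℤ , 1ℤ , 1ℤ ⟩

trapped-≢0 : ∀ {v} → Trapped v → v ≢ 0v
trapped-≢0 (cone⁺ _ _ (ℤ.+≤+ ())) refl
trapped-≢0 (cone⁻ _ _ ()) refl

trapped-step : ∀ {n v} → Bit n → Trapped v → Trapped (n +ᶜ mulY v)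
trapped-step bn (cone⁺ a≥0 b≤0 c≥1) = cone⁻
  (ℤP.i≤j⇒i-j≤0 (ℤP.≤-trans (bit-≤1 bn) c≥1))
  (ℤP.+-mono-≤ a≥0 (ℤP.≤-trans (decide-≤ℤ {0ℤ}) c≥1))
  (ℤP.+-mono-≤ b≤0 (ℤP.neg-mono-≤ c≥1))
trapped-step bn (cone⁻ a≤0 b≥0 c≤-1) = cone⁺
  (ℤP.≤-trans decide-≤ℤ (ℤP.+-mono-≤ (bit-≥0 bn) (ℤP.neg-mono-≤ c≤-1)))
  (ℤP.+-mono-≤ a≤0 (ℤP.≤-trans c≤-1 (decide-≤ℤ {j = 0ℤ})))
  (ℤP.+-mono-≤ b≥0 (ℤP.neg-mono-≤ c≤-1))
trapped-step b0 ⟨-1,1,0⟩ = cone⁺ decide-≤ℤ decide-≤ℤ decide-≤ℤ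
trapped-step b1 ⟨-1,1,0⟩ = cone⁺ decide-≤ℤ decide-≤ℤ decide-≤ℤ
trapped-step b0 ⟨-1,2,0⟩ = cone⁺ decide-≤ℤ decide-≤ℤ decide-≤ℤ
trapped-step b1 ⟨-1,2,0⟩ = cone⁺ decide-≤ℤ decide-≤ℤ decide-≤ℤ
trapped-step b0 ⟨0,1,0⟩  = cone⁺ decide-≤ℤ decide-≤ℤ decide-≤ℤ
trapped-step b1 ⟨0,1,0⟩  = cone⁺ decide-≤ℤ decide-≤ℤ decide-≤ℤ
trapped-step b0 ⟨0,1,1⟩  = ⟨-1,1,0⟩
trapped-step b1 ⟨0,1,1⟩  = ⟨0,1,0⟩
trapped-step b0 ⟨0,2,0⟩  = cone⁺ decide-≤ℤ decide-≤ℤ decide-≤ℤ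
trapped-step b1 ⟨0,2,0⟩  = cone⁺ decide-≤ℤ decide-≤ℤ decide-≤ℤ
trapped-step b0 ⟨1,0,0⟩  = ⟨0,1,0⟩
trapped-step b1 ⟨1,0,0⟩  = ⟨1,1,0⟩
trapped-step b0 ⟨1,1,0⟩  = ⟨0,1,1⟩
trapped-step b1 ⟨1,1,0⟩  = ⟨1,1,1⟩
trapped-step b0 ⟨1,1,1⟩  = ⟨-1,2,0⟩
trapped-step b1 ⟨1,1,1⟩  = ⟨0,2,0⟩

ev-mulY-trapped : ∀ a f → All Bit (a ∷ f) → last (a ∷ f) ≢ just 0ℤ → Trapped (ev mulY (a ∷ f))
ev-mulY-trapped a []      (b0 ∷ []) last≢0 = ⊥-elim (last≢0 refl)
ev-mulY-trapped a []      (b1 ∷ []) last≢0 = ⟨1,0,0⟩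
ev-mulY-trapped a (b ∷ f) (bit ∷ bits) last≢0 = trapped-step bit (ev-mulY-trapped b f bits last≢0)

-- If n(Y⁻¹) = 0, peeling off coefficients from the constant term leaves tails t with
-- t(Y⁻¹) = -Y h, where h runs through the mulY-Horner states of the reversed polynomial.
ev-mulY⁻¹-avoids : ∀ f → All Bit f → ∀ {h} → Trapped h → ev mulY⁻¹ f ≢ ⊖ mulY h
ev-mulY⁻¹-avoids []      []           {h} trapped eq = trapped-≢0 trapped (⊖mulY-injective h (sym eq))
ev-mulY⁻¹-avoids (n ∷ f) (bit ∷ bits) {h} trapped eq =
  ev-mulY⁻¹-avoids f bits (trapped-step bit trapped) (begin
    ev mulY⁻¹ f                          ≡⟨ unstep-inverse n (ev mulY⁻¹ f) ⟨
    unstep n (n +ᶜ mulY⁻¹ (ev mulY⁻¹ f))  ≡⟨ cong (unstep n) eq ⟩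
    unstep n (⊖ mulY h)                  ≡⟨ unstep-⊖mulY n h ⟩
    ⊖ mulY (n +ᶜ mulY h)                 ∎)
  where open ≡-Reasoning

newman-last≢0 : ∀ {a f} → Newman (a ∷ f) → last (a ∷ f) ≢ just 0ℤ
newman-last≢0 (_ , _ , ad , last≡ad , ad≢0) last≡0 = ad≢0 (just-injective (trans (sym last≡ad) last≡0))

annihilates-mulY⇒¬DividesSomeNewman : ∀ f → Annihilates f mulY → ¬ DividesSomeNewman f
annihilates-mulY⇒¬DividesSomeNewman f ann ((a ∷ n) , newman@(bits , _) , f∣n) =
  trapped-≢0 (ev-mulY-trapped a n bits (newman-last≢0 newman)) (∣ₚ⇒ev≡0 mulY-linear f _ ann f∣n)

annihilates-mulY⁻¹⇒¬DividesSomeNewman : ∀ f → Annihilates f mulY⁻¹ → ¬ DividesSomeNewman f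
annihilates-mulY⁻¹⇒¬DividesSomeNewman f ann ((_ ∷ n) , (_ ∷ bits , refl , _) , f∣n) =
  ev-mulY⁻¹-avoids n bits ⟨1,0,0⟩
    (trans (sym (unstep-inverse 1ℤ (ev mulY⁻¹ n))) (cong (unstep 1ℤ) (∣ₚ⇒ev≡0 mulY⁻¹-linear f _ ann f∣n)))

-- Roots by bisection

decide-≤ : ∀ {p q} {p≤q : True (p ℚP.≤? q)} → p ≤ q
decide-≤ {p≤q = p≤q} = toWitness p≤q

1/suc : ℕ → ℚ
1/suc n = + 1 ℚ./ suc n

1/suc-nonNeg : ∀ n → 0ℚ ≤ 1/suc n
1/suc-nonNeg n = ℚP.nonNegative⁻¹ (1/suc n) {{ℚP.normalize-nonNeg 1 (suc n)}}

/-*-/-≤ : ∀ a b c m n k → a ℕ.* b ℕ.* suc k ℕ.≤ c ℕ.* (suc m ℕ.* suc n) →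
          (+ a ℚ./ suc m) * (+ b ℚ./ suc n) ≤ + c ℚ./ suc k
/-*-/-≤ a b c m n k ineq = ℚP.toℚᵘ-cancel-≤ (begin
  ℚ.toℚᵘ (x * y)                 ≃⟨ ℚP.toℚᵘ-homo-* x y ⟩
  ℚ.toℚᵘ x ℚᵘ.* ℚ.toℚᵘ y         ≃⟨ ℚᵘP.*-cong (ℚP.toℚᵘ-fromℚᵘ (mkℚᵘ (+ a) m)) (ℚP.toℚᵘ-fromℚᵘ (mkℚᵘ (+ b) n)) ⟩
  mkℚᵘ (+ a) m ℚᵘ.* mkℚᵘ (+ b) n ≤⟨ ℚᵘ.*≤* cross ⟩
  mkℚᵘ (+ c) k                   ≃⟨ ℚP.toℚᵘ-fromℚᵘ (mkℚᵘ (+ c) k) ⟨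
  ℚ.toℚᵘ (+ c ℚ./ suc k)         ∎)
  where
  open ℚᵘP.≤-Reasoning
  x = + a ℚ./ suc m
  y = + b ℚ./ suc n
  cross : (+ a ℤ.* + b) ℤ.* + suc k ℤ.≤ + c ℤ.* + suc (ℕ.pred (suc m ℕ.* suc n))
  cross = subst₂ ℤ._≤_
    (trans (ℤP.pos-* (a ℕ.* b) (suc k)) (cong (ℤ._* + suc k) (ℤP.pos-* a b)))
    (ℤP.pos-* c (suc m ℕ.* suc n))
    (+≤+ ineq)

1/suc-halving : ∀ n → 1/suc n * ½ ≤ 1/suc (suc n)
1/suc-halving n = /-*-/-≤ 1 1 1 n 1 (suc n) (begin
  1 ℕ.* 1 ℕ.* suc (suc n)  ≡⟨ ℕP.*-identityˡ (suc (suc n)) ⟩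
  2 ℕ.+ n                  ≤⟨ ℕP.+-monoʳ-≤ 2 (ℕP.m≤m+n n n) ⟩
  2 ℕ.+ (n ℕ.+ n)          ≡⟨ solve-ℕ n ⟩
  1 ℕ.* (suc n ℕ.* 2)      ∎)
  where
  open ℕP.≤-Reasoning
  solve-ℕ : ∀ n → 2 ℕ.+ (n ℕ.+ n) ≡ 1 ℕ.* (suc n ℕ.* 2)
  solve-ℕ = solve-∀

ℕ*1/suc-≤ : ∀ L n k → L ℕ.* suc k ℕ.≤ suc n → (+ L ℚ./ 1) * 1/suc n ≤ 1/suc k
ℕ*1/suc-≤ L n k ineq = /-*-/-≤ L 1 1 0 n k (subst₂ ℕ._≤_
  (cong (ℕ._* suc k) (sym (ℕP.*-identityʳ L)))
  (sym (trans (ℕP.*-identityˡ (1 ℕ.* suc n)) (ℕP.*-identityˡ (suc n))))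
  ineq)

p≤q⇒0≤q-p : ∀ {p q} → p ≤ q → 0ℚ ≤ q - p
p≤q⇒0≤q-p {p} {q} p≤q = subst (λ w → w ≤ q - p) (ℚP.+-inverseʳ p) (ℚP.+-monoˡ-≤ (- p) p≤q)

0≤q-p⇒p≤q : ∀ {p q} → 0ℚ ≤ q - p → p ≤ q
0≤q-p⇒p≤q {p} {q} 0≤q-p = subst₂ _≤_ (ℚP.+-identityʳ p) (p+[q-p]≡q p q) (ℚP.+-monoʳ-≤ p 0≤q-p)
  where
  p+[q-p]≡q : ∀ p q → p + (q - p) ≡ q
  p+[q-p]≡q = solveℚ 2 (λ p q → p :+ (q :- p) := q) refl

*-mono-≤-nonNeg : ∀ {p q r s} → 0ℚ ≤ p → p ≤ q → 0ℚ ≤ r → r ≤ s → p * r ≤ q * s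
*-mono-≤-nonNeg {p} {q} {r} {s} 0≤p p≤q 0≤r r≤s = ℚP.≤-trans
  (ℚP.*-monoʳ-≤-nonNeg r {{ℚ.nonNegative 0≤r}} p≤q)
  (ℚP.*-monoˡ-≤-nonNeg q {{ℚ.nonNegative (ℚP.≤-trans 0≤p p≤q)}} r≤s)

∣p-q∣≡∣q-p∣ : ∀ p q → ∣ p - q ∣ ≡ ∣ q - p ∣
∣p-q∣≡∣q-p∣ p q = trans (cong ∣_∣ (p-q≡-[q-p] p q)) (ℚP.∣-p∣≡∣p∣ (q - p))
  where
  p-q≡-[q-p] : ∀ p q → p - q ≡ - (q - p)
  p-q≡-[q-p] = solveℚ 2 (λ p q → p :- q := :- (q :- p)) refl

trit-∣∣≤1 : ∀ {a} → Trit a → ∣ a ℚ./ 1 ∣ ≤ 1ℚ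
trit-∣∣≤1 t-1 = decide-≤
trit-∣∣≤1 t0  = decide-≤
trit-∣∣≤1 t1  = decide-≤

sup-bound : ℚ → ℕ → ℚ
sup-bound r zero    = 0ℚ
sup-bound r (suc n) = 1ℚ + r * sup-bound r n

lipschitz-bound : ℚ → ℕ → ℚ
lipschitz-bound r zero    = 0ℚ
lipschitz-bound r (suc n) = r * lipschitz-bound r n + sup-bound r n

evalℚ-bound : ∀ {r x} P → All Trit P → ∣ x ∣ ≤ r → ∣ evalℚ P x ∣ ≤ sup-bound r (length P)
evalℚ-bound []      []       _     = ℚP.≤-refl
evalℚ-bound {r} {x} (a ∷ P) (t ∷ ts) ∣x∣≤r = begin
  ∣ a ℚ./ 1 + x * evalℚ P x ∣            ≤⟨ ℚP.∣p+q∣≤∣p∣+∣q∣ (a ℚ./ 1) (x * evalℚ P x) ⟩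
  ∣ a ℚ./ 1 ∣ + ∣ x * evalℚ P x ∣        ≡⟨ cong (λ w → ∣ a ℚ./ 1 ∣ + w) (ℚP.∣p*q∣≡∣p∣*∣q∣ x (evalℚ P x)) ⟩
  ∣ a ℚ./ 1 ∣ + ∣ x ∣ * ∣ evalℚ P x ∣    ≤⟨ ℚP.+-mono-≤ (trit-∣∣≤1 t)
                                              (*-mono-≤-nonNeg (ℚP.0≤∣p∣ x) ∣x∣≤r (ℚP.0≤∣p∣ (evalℚ P x))
                                                (evalℚ-bound P ts ∣x∣≤r)) ⟩
  1ℚ + r * sup-bound r (length P)        ∎
  where open ℚP.≤-Reasoning

evalℚ-lipschitz : ∀ {r x y} P → All Trit P → ∣ x ∣ ≤ r → ∣ y ∣ ≤ r →
                  ∣ evalℚ P x - evalℚ P y ∣ ≤ lipschitz-bound r (length P) * ∣ x - y ∣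
evalℚ-lipschitz {x = x} {y} []      []       _     _     = ℚP.≤-reflexive (sym (ℚP.*-zeroˡ ∣ x - y ∣))
evalℚ-lipschitz {r} {x} {y} (a ∷ P) (t ∷ ts) ∣x∣≤r ∣y∣≤r = begin
  ∣ (a ℚ./ 1 + x * e) - (a ℚ./ 1 + y * f) ∣  ≡⟨ cong ∣_∣ (horner-difference (a ℚ./ 1) x y e f) ⟩
  ∣ x * (e - f) + (x - y) * f ∣              ≤⟨ ℚP.∣p+q∣≤∣p∣+∣q∣ (x * (e - f)) ((x - y) * f) ⟩
  ∣ x * (e - f) ∣ + ∣ (x - y) * f ∣          ≡⟨ cong₂ _+_ (ℚP.∣p*q∣≡∣p∣*∣q∣ x (e - f)) (ℚP.∣p*q∣≡∣p∣*∣q∣ (x - y) f) ⟩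
  ∣ x ∣ * ∣ e - f ∣ + d * ∣ f ∣              ≤⟨ ℚP.+-mono-≤
                                                  (*-mono-≤-nonNeg (ℚP.0≤∣p∣ x) ∣x∣≤r (ℚP.0≤∣p∣ (e - f))
                                                    (evalℚ-lipschitz P ts ∣x∣≤r ∣y∣≤r))
                                                  (ℚP.*-monoˡ-≤-nonNeg d {{ℚP.∣-∣-nonNeg (x - y)}}
                                                    (evalℚ-bound P ts ∣y∣≤r)) ⟩
  r * (lipschitz-bound r (length P) * d) + d * sup-bound r (length P)
                                             ≡⟨ collect r (lipschitz-bound r (length P)) d (sup-bound r (length P)) ⟩
  lipschitz-bound r (length (a ∷ P)) * d     ∎
  where
  open ℚP.≤-Reasoning
  e = evalℚ P x
  f = evalℚ P y
  d = ∣ x - y ∣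
  horner-difference : ∀ a x y e f → (a + x * e) - (a + y * f) ≡ x * (e - f) + (x - y) * f
  horner-difference = solveℚ 5 (λ a x y e f → (a :+ x :* e) :- (a :+ y :* f) := x :* (e :- f) :+ (x :- y) :* f) refl
  collect : ∀ r L d B → r * (L * d) + d * B ≡ (r * L + B) * d
  collect = solveℚ 4 (λ r L d B → r :* (L :* d) :+ d :* B := (r :* L :+ B) :* d) refl

p≤p+q : ∀ {p q} → 0ℚ ≤ q → p ≤ p + q
p≤p+q {p} {q} 0≤q = subst (λ w → w ≤ p + q) (ℚP.+-identityʳ p) (ℚP.+-monoʳ-≤ p 0≤q)

module Bisection (f : ℚ → ℚ) (L : ℕ) (l₀ u₀ : ℚ)
  (lipschitz : ∀ {x y} → l₀ ≤ x → x ≤ u₀ → l₀ ≤ y → y ≤ u₀ → ∣ f x - f y ∣ ≤ (+ L ℚ./ 1) * ∣ x - y ∣)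
  (l₀≤u₀ : l₀ ≤ u₀) (u₀-l₀≤1 : u₀ - l₀ ≤ 1ℚ) (0≤f-l₀ : 0ℚ ≤ f l₀) (f-u₀≤0 : f u₀ ≤ 0ℚ) where

  midpoint : ℚ → ℚ → ℚ
  midpoint l u = (l + u) * ½

  halve : ℚ × ℚ → ℚ × ℚ
  halve (l , u) with 0ℚ ℚP.≤? f (midpoint l u)
  ... | yes _ = midpoint l u , u
  ... | no  _ = l , midpoint l u

  interval : ℕ → ℚ × ℚ
  interval zero    = l₀ , u₀
  interval (suc n) = halve (interval n)

  lower upper : ℕ → ℚ
  lower n = proj₁ (interval n)
  upper n = proj₂ (interval n)

  record Bracket (n : ℕ) (l u : ℚ) : Set where
    field
      l≤u    : l ≤ u
      0≤f-l  : 0ℚ ≤ f l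
      f-u≤0  : f u ≤ 0ℚ
      narrow : u - l ≤ 1/suc n

  module _ {l u : ℚ} (l≤u : l ≤ u) where

    half-width-nonNeg : 0ℚ ≤ (u - l) * ½
    half-width-nonNeg = ℚP.≤-trans (ℚP.≤-reflexive (sym (ℚP.*-zeroˡ ½)))
      (ℚP.*-monoʳ-≤-nonNeg ½ (p≤q⇒0≤q-p l≤u))

    midpoint-l : midpoint l u - l ≡ (u - l) * ½
    midpoint-l = solveℚ 2 (λ l u → (l :+ u) :* con ½ :- l := (u :- l) :* con ½) refl l u

    u-midpoint : u - midpoint l u ≡ (u - l) * ½
    u-midpoint = solveℚ 2 (λ l u → u :- (l :+ u) :* con ½ := (u :- l) :* con ½) refl l u

    l≤midpoint : l ≤ midpoint l u
    l≤midpoint = 0≤q-p⇒p≤q (subst (0ℚ ≤_) (sym midpoint-l) half-width-nonNeg)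

    midpoint≤u : midpoint l u ≤ u
    midpoint≤u = 0≤q-p⇒p≤q (subst (0ℚ ≤_) (sym u-midpoint) half-width-nonNeg)

    halve-nested : l ≤ proj₁ (halve (l , u)) × proj₂ (halve (l , u)) ≤ u
    halve-nested with 0ℚ ℚP.≤? f (midpoint l u)
    ... | yes _ = l≤midpoint , ℚP.≤-refl
    ... | no  _ = ℚP.≤-refl , midpoint≤u

  halve-bracket : ∀ {n l u} → Bracket n l u → Bracket (suc n) (proj₁ (halve (l , u))) (proj₂ (halve (l , u)))
  halve-bracket {n} {l} {u} br with 0ℚ ℚP.≤? f (midpoint l u)
  ... | yes 0≤f-m = record
    { l≤u = midpoint≤u l≤u ; 0≤f-l = 0≤f-m ; f-u≤0 = f-u≤0
    ; narrow = subst (_≤ 1/suc (suc n)) (sym (u-midpoint l≤u)) halved }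
    where
    open Bracket br
    halved = ℚP.≤-trans (ℚP.*-monoʳ-≤-nonNeg ½ narrow) (1/suc-halving n)
  ... | no ¬0≤f-m = record
    { l≤u = l≤midpoint l≤u ; 0≤f-l = 0≤f-l ; f-u≤0 = ℚP.<⇒≤ (ℚP.≰⇒> ¬0≤f-m)
    ; narrow = subst (_≤ 1/suc (suc n)) (sym (midpoint-l l≤u)) halved }
    where
    open Bracket br
    halved = ℚP.≤-trans (ℚP.*-monoʳ-≤-nonNeg ½ narrow) (1/suc-halving n)

  bracket : ∀ n → Bracket n (lower n) (upper n)
  bracket zero    = record { l≤u = l₀≤u₀ ; 0≤f-l = 0≤f-l₀ ; f-u≤0 = f-u₀≤0 ; narrow = u₀-l₀≤1 }
  bracket (suc n) = halve-bracket (bracket n)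

  nested : ∀ m d → lower m ≤ lower (m ℕ.+ d) × upper (m ℕ.+ d) ≤ upper m
  nested m zero    rewrite ℕP.+-identityʳ m = ℚP.≤-refl , ℚP.≤-refl
  nested m (suc d) rewrite ℕP.+-suc m d =
    let lm≤l , u≤um = nested m d
        l≤l′ , u′≤u = halve-nested (Bracket.l≤u (bracket (m ℕ.+ d)))
    in ℚP.≤-trans lm≤l l≤l′ , ℚP.≤-trans u′≤u u≤um

  lower-close : ∀ m d → ∣ lower (m ℕ.+ d) - lower m ∣ ≤ 1/suc m
  lower-close m d = begin
    ∣ lower (m ℕ.+ d) - lower m ∣  ≡⟨ ℚP.0≤p⇒∣p∣≡p (p≤q⇒0≤q-p lm≤l) ⟩
    lower (m ℕ.+ d) - lower m      ≤⟨ ℚP.+-monoˡ-≤ (- lower m) l≤um ⟩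
    upper m - lower m              ≤⟨ Bracket.narrow (bracket m) ⟩
    1/suc m                        ∎
    where
    open ℚP.≤-Reasoning
    lm≤l = proj₁ (nested m d)
    l≤um = ℚP.≤-trans (Bracket.l≤u (bracket (m ℕ.+ d))) (proj₂ (nested m d))

  lower-regular : IsRegularCauchy lower
  lower-regular m n with ℕP.≤-total m n
  ... | inj₁ m≤n = begin
    ∣ lower m - lower n ∣            ≡⟨ ∣p-q∣≡∣q-p∣ (lower m) (lower n) ⟩
    ∣ lower n - lower m ∣            ≡⟨ cong (λ k → ∣ lower k - lower m ∣) (ℕP.m+[n∸m]≡n m≤n) ⟨
    ∣ lower (m ℕ.+ (n ℕ.∸ m)) - lower m ∣ ≤⟨ lower-close m (n ℕ.∸ m) ⟩
    1/suc m                          ≤⟨ p≤p+q (1/suc-nonNeg n) ⟩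
    1/suc m + 1/suc n                ∎
    where open ℚP.≤-Reasoning
  ... | inj₂ n≤m = begin
    ∣ lower m - lower n ∣            ≡⟨ cong (λ k → ∣ lower k - lower n ∣) (ℕP.m+[n∸m]≡n n≤m) ⟨
    ∣ lower (n ℕ.+ (m ℕ.∸ n)) - lower n ∣ ≤⟨ lower-close n (m ℕ.∸ n) ⟩
    1/suc n                          ≤⟨ p≤p+q (1/suc-nonNeg m) ⟩
    1/suc n + 1/suc m                ≡⟨ ℚP.+-comm (1/suc n) (1/suc m) ⟩
    1/suc m + 1/suc n                ∎
    where open ℚP.≤-Reasoning

  l₀≤lower : ∀ n → l₀ ≤ lower n
  l₀≤lower n = proj₁ (nested 0 n)

  upper≤u₀ : ∀ n → upper n ≤ u₀
  upper≤u₀ n = proj₂ (nested 0 n)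

  f-lower→0 : ∀ k → ∃ λ N → ∀ n → N ℕ.≤ n → ∣ f (lower n) ∣ ≤ 1/suc k
  f-lower→0 k = L ℕ.* suc k , λ n N≤n →
    let open Bracket (bracket n)
        l = lower n
        u = upper n
        l₀≤u = ℚP.≤-trans (l₀≤lower n) l≤u
        l≤u₀ = ℚP.≤-trans l≤u (upper≤u₀ n)
    in begin
    ∣ f l ∣                  ≡⟨ ℚP.0≤p⇒∣p∣≡p 0≤f-l ⟩
    f l                      ≤⟨ p≤p+q (ℚP.neg-antimono-≤ f-u≤0) ⟩
    f l - f u                ≡⟨ ℚP.0≤p⇒∣p∣≡p (ℚP.≤-trans 0≤f-l (p≤p+q (ℚP.neg-antimono-≤ f-u≤0))) ⟨
    ∣ f l - f u ∣            ≤⟨ lipschitz (l₀≤lower n) l≤u₀ l₀≤u (upper≤u₀ n) ⟩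
    (+ L ℚ./ 1) * ∣ l - u ∣  ≡⟨ cong ((+ L ℚ./ 1) *_) (trans (∣p-q∣≡∣q-p∣ l u) (ℚP.0≤p⇒∣p∣≡p (p≤q⇒0≤q-p l≤u))) ⟩
    (+ L ℚ./ 1) * (u - l)    ≤⟨ ℚP.*-monoˡ-≤-nonNeg (+ L ℚ./ 1) {{ℚP.normalize-nonNeg L 1}} narrow ⟩
    (+ L ℚ./ 1) * 1/suc n    ≤⟨ ℕ*1/suc-≤ L n k (ℕP.≤-trans N≤n (ℕP.n≤1+n n)) ⟩
    1/suc k                  ∎
    where open ℚP.≤-Reasoning

sign-change⇒root : ∀ P r (L : ℕ) {l u} → All Trit P → lipschitz-bound r (length P) ≤ + L ℚ./ 1 →
                   0ℚ ≤ l → l ≤ u → u ≤ r → u - l ≤ 1ℚ → 0ℚ ≤ evalℚ P l → evalℚ P u ≤ 0ℚ →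
                   HasNonnegRealRoot P
sign-change⇒root P r L {l} {u} trits lip≤L 0≤l l≤u u≤r u-l≤1 0≤P-l P-u≤0 =
  lower , lower-regular , (λ n → ℚP.≤-trans 0≤l (l₀≤lower n)) , f-lower→0
  where
  ∣∣≤r : ∀ {x} → l ≤ x → x ≤ u → ∣ x ∣ ≤ r
  ∣∣≤r {x} l≤x x≤u = subst (_≤ r) (sym (ℚP.0≤p⇒∣p∣≡p (ℚP.≤-trans 0≤l l≤x))) (ℚP.≤-trans x≤u u≤r)

  lipschitz : ∀ {x y} → l ≤ x → x ≤ u → l ≤ y → y ≤ u →
              ∣ evalℚ P x - evalℚ P y ∣ ≤ (+ L ℚ./ 1) * ∣ x - y ∣
  lipschitz {x} {y} l≤x x≤u l≤y y≤u = ℚP.≤-trans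
    (evalℚ-lipschitz P trits (∣∣≤r l≤x x≤u) (∣∣≤r l≤y y≤u))
    (ℚP.*-monoʳ-≤-nonNeg ∣ x - y ∣ {{ℚP.∣-∣-nonNeg (x - y)}} lip≤L)

  open Bisection (evalℚ P) L l u lipschitz l≤u u-l≤1 0≤P-l P-u≤0

bounded-below⇒¬root : ∀ P k → (∀ x → 0ℚ ≤ x → 1/suc k ℚ.< ∣ evalℚ P x ∣) → ¬ HasNonnegRealRoot P
bounded-below⇒¬root P k bound (s , _ , 0≤s , converges) =
  ℚP.<-irrefl refl (ℚP.<-≤-trans (bound (s N) (0≤s N)) (P-s≤ N ℕP.≤-refl))
  where
  N = proj₁ (converges k)
  P-s≤ = proj₂ (converges k)

neg-/1 : ∀ a → (ℤ.- a) ℚ./ 1 ≡ - (a ℚ./ 1)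
neg-/1 (+ zero)  = refl
neg-/1 (+ suc n) = refl
neg-/1 -[1+ n ]  = sym (neg-involutive (+ suc n ℚ./ 1))
  where
  neg-involutive : ∀ p → - - p ≡ p
  neg-involutive = solveℚ 1 (λ p → :- :- p := p) refl

evalℚ-negₚ : ∀ P x → evalℚ (negₚ P) x ≡ - evalℚ P x
evalℚ-negₚ []      x = refl
evalℚ-negₚ (a ∷ P) x = begin
  (ℤ.- a) ℚ./ 1 + x * evalℚ (negₚ P) x  ≡⟨ cong₂ (λ c e → c + x * e) (neg-/1 a) (evalℚ-negₚ P x) ⟩
  - (a ℚ./ 1) + x * - evalℚ P x         ≡⟨ neg-distrib (a ℚ./ 1) x (evalℚ P x) ⟩
  - (a ℚ./ 1 + x * evalℚ P x)           ∎
  where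
  open ≡-Reasoning
  neg-distrib : ∀ c x e → - c + x * - e ≡ - (c + x * e)
  neg-distrib = solveℚ 3 (λ c x e → :- c :+ x :* :- e := :- (c :+ x :* e)) refl

HasNonnegRealRoot-negₚ : ∀ P → HasNonnegRealRoot P → HasNonnegRealRoot (negₚ P)
HasNonnegRealRoot-negₚ P (s , regular , 0≤s , converges) = s , regular , 0≤s , λ k →
  proj₁ (converges k) , λ n N≤n →
    subst (_≤ 1/suc k) (sym (trans (cong ∣_∣ (evalℚ-negₚ P (s n))) (ℚP.∣-p∣≡∣p∣ (evalℚ P (s n)))))
      (proj₂ (converges k) n N≤n)

*-nonNeg : ∀ {p q} → 0ℚ ≤ p → 0ℚ ≤ q → 0ℚ ≤ p * q
*-nonNeg 0≤p 0≤q = *-mono-≤-nonNeg ℚP.≤-refl 0≤p ℚP.≤-refl 0≤q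

square-nonNeg : ∀ p → 0ℚ ≤ p * p
square-nonNeg p with ℚP.≤-total 0ℚ p
... | inj₁ 0≤p = *-nonNeg 0≤p 0≤p
... | inj₂ p≤0 = subst (0ℚ ≤_) (neg*neg p) (*-nonNeg (ℚP.neg-antimono-≤ p≤0) (ℚP.neg-antimono-≤ p≤0))
  where
  neg*neg : ∀ p → - p * - p ≡ p * p
  neg*neg = solveℚ 1 (λ p → :- p :* :- p := p :* p) refl

¾ : ℚ
¾ = + 3 ℚ./ 4

¾≤⇒½<∣∣ : ∀ {v} → ¾ ≤ v → ½ ℚ.< ∣ v ∣
¾≤⇒½<∣∣ {v} ¾≤v = ℚP.<-≤-trans ½<¾ (subst (¾ ≤_) (sym (ℚP.0≤p⇒∣p∣≡p (ℚP.≤-trans decide-≤ ¾≤v))) ¾≤v)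
  where
  ½<¾ : ½ ℚ.< ¾
  ½<¾ = toWitness {a? = ½ ℚP.<? ¾} _

p-¾≤ : ∀ x → 0ℚ ≤ x → ¾ ≤ evalℚ pPoly x
p-¾≤ x 0≤x = begin
  ¾                                  ≡⟨ ℚP.+-identityˡ ¾ ⟨
  0ℚ + ¾                             ≤⟨ ℚP.+-monoˡ-≤ ¾ (ℚP.+-mono-≤ (*-nonNeg (*-nonNeg 0≤x 0≤x) 0≤x) (square-nonNeg (x - ½))) ⟩
  x * x * x + (x - ½) * (x - ½) + ¾  ≡⟨ p-sum-of-squares x ⟨
  evalℚ pPoly x                      ∎
  where
  open ℚP.≤-Reasoning
  p-sum-of-squares : ∀ x → evalℚ pPoly x ≡ x * x * x + (x - ½) * (x - ½) + ¾
  p-sum-of-squares = solveℚ 1 (λ x →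
    con 1ℚ :+ x :* (con (- 1ℚ) :+ x :* (con 1ℚ :+ x :* (con 1ℚ :+ x :* con 0ℚ)))
      := x :* x :* x :+ (x :- con ½) :* (x :- con ½) :+ con ¾) refl

p*-¾≤ : ∀ x → 0ℚ ≤ x → ¾ ≤ evalℚ pStar x
p*-¾≤ x 0≤x = begin
  ¾                                         ≤⟨ decide-≤ ⟩
  1ℚ                                        ≡⟨ ℚP.+-identityˡ 1ℚ ⟨
  0ℚ + 1ℚ                                   ≤⟨ ℚP.+-monoˡ-≤ 1ℚ (ℚP.+-mono-≤ (*-nonNeg 0≤x (square-nonNeg (x - ½)))
                                                                           (*-nonNeg (decide-≤ {0ℚ} {¾}) 0≤x)) ⟩
  x * ((x - ½) * (x - ½)) + ¾ * x + 1ℚ      ≡⟨ p*-sum-of-squares x ⟨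
  evalℚ pStar x                             ∎
  where
  open ℚP.≤-Reasoning
  p*-sum-of-squares : ∀ x → evalℚ pStar x ≡ x * ((x - ½) * (x - ½)) + ¾ * x + 1ℚ
  p*-sum-of-squares = solveℚ 1 (λ x →
    con 1ℚ :+ x :* (con 1ℚ :+ x :* (con (- 1ℚ) :+ x :* (con 1ℚ :+ x :* con 0ℚ)))
      := x :* ((x :- con ½) :* (x :- con ½)) :+ con ¾ :* x :+ con 1ℚ) refl

p-¬root : ¬ HasNonnegRealRoot pPoly
p-¬root = bounded-below⇒¬root pPoly 1 (λ x 0≤x → ¾≤⇒½<∣∣ (p-¾≤ x 0≤x))

p*-¬root : ¬ HasNonnegRealRoot pStar
p*-¬root = bounded-below⇒¬root pStar 1 (λ x 0≤x → ¾≤⇒½<∣∣ (p*-¾≤ x 0≤x))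

-- Classification of the Borwein polynomials of degree at most 3

Exceptional : Poly → Set
Exceptional P = P ≡ pPoly ⊎ P ≡ negₚ pPoly ⊎ P ≡ pStar ⊎ P ≡ negₚ pStar

Outcome : Poly → Set
Outcome P = DividesSomeNewman P ⊎ HasNonnegRealRoot P ⊎ Exceptional P

DividesSomeNewman-negₚ : ∀ P → DividesSomeNewman P → DividesSomeNewman (negₚ P)
DividesSomeNewman-negₚ P (n , newman , q , Pq≈n) =
  n , newman , negₚ q , subst (λ r → r ≈ₚ n) (sym (negₚ-*ₚ-negₚ P q)) Pq≈n

Exceptional-negₚ : ∀ {P} → Exceptional P → Exceptional (negₚ P)
Exceptional-negₚ (inj₁ refl)               = inj₂ (inj₁ refl)
Exceptional-negₚ (inj₂ (inj₁ refl))        = inj₁ refl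
Exceptional-negₚ (inj₂ (inj₂ (inj₁ refl))) = inj₂ (inj₂ (inj₂ refl))
Exceptional-negₚ (inj₂ (inj₂ (inj₂ refl))) = inj₂ (inj₂ (inj₁ refl))

Outcome-negₚ : ∀ P → Outcome P → Outcome (negₚ P)
Outcome-negₚ P = Sum.map (DividesSomeNewman-negₚ P) (Sum.map (HasNonnegRealRoot-negₚ P) Exceptional-negₚ)

Borwein-negₚ : ∀ {P} → Borwein P → Borwein (negₚ P)
Borwein-negₚ {a ∷ P} (trits , a≢0 , ad , last≡ad , ad≢0) =
  AllP.map⁺ (All.map trit-neg trits) , neg-≢0 a≢0 ,
  ℤ.- ad , trans (last-map _ (a ∷ P)) (cong (Maybe.map _) last≡ad) , neg-≢0 ad≢0
  where
  trit-neg : ∀ {a} → Trit a → Trit (ℤ.- a)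
  trit-neg t-1 = t1
  trit-neg t0  = t0
  trit-neg t1  = t-1
  neg-≢0 : ∀ {a} → a ≢ 0ℤ → ℤ.- a ≢ 0ℤ
  neg-≢0 {a} a≢0 -a≡0 = a≢0 (trans (sym (ℤP.neg-involutive a)) (cong ℤ.-_ -a≡0))

bit? : ∀ a → Dec (Bit a)
bit? (+ zero)        = yes b0
bit? (+ suc zero)    = yes b1
bit? (+ suc (suc _)) = no λ ()
bit? -[1+ _ ]        = no λ ()

nonzero-last? : ∀ xs → Dec (∃ λ ad → last xs ≡ just ad × ad ≢ 0ℤ)
nonzero-last? xs with last xs
... | nothing = no λ ()
... | just ad with ad ℤ.≟ 0ℤ
...   | yes ad≡0 = no λ { (_ , refl , ad≢0) → ad≢0 ad≡0 }
...   | no  ad≢0 = yes (ad , refl , ad≢0)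

newman? : ∀ n → Dec (Newman n)
newman? []      = no λ ()
newman? (a ∷ n) = all? bit? (a ∷ n) ×-dec (a ℤ.≟ 1ℤ) ×-dec nonzero-last? (a ∷ n)

newman-multiple : ∀ {P} q {newman : True (newman? (P *ₚ q))} → Outcome P
newman-multiple {P} q {newman} = inj₁ (P *ₚ q , toWitness newman , q , λ _ → refl)

-- 17 = lipschitz-bound 2 4 suffices up to degree 3.
root-between : ∀ {P} (l u : ℚ) → All Trit P →
  {_ : True (0ℚ ℚP.≤? l)} {_ : True (l ℚP.≤? u)} {_ : True (u ℚP.≤? + 2 ℚ./ 1)} {_ : True (u - l ℚP.≤? 1ℚ)}
  {_ : True (0ℚ ℚP.≤? evalℚ P l)} {_ : True (evalℚ P u ℚP.≤? 0ℚ)}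
  {_ : True (lipschitz-bound (+ 2 ℚ./ 1) (length P) ℚP.≤? + 17 ℚ./ 1)} → Outcome P
root-between {P} l u trits {0≤l} {l≤u} {u≤2} {u-l≤1} {0≤P-l} {P-u≤0} {lip≤17} =
  inj₂ (inj₁ (sign-change⇒root P (+ 2 ℚ./ 1) 17 trits (toWitness lip≤17)
    (toWitness 0≤l) (toWitness l≤u) (toWitness u≤2) (toWitness u-l≤1) (toWitness 0≤P-l) (toWitness P-u≤0)))

exceptional : ∀ {P} → Exceptional P → Outcome P
exceptional = inj₂ ∘ inj₂

-- Negation preserves all three outcomes, so it suffices to classify the polynomials with a₀ = 1.
classify⁺ : ∀ {P} → Borwein (1ℤ ∷ P) → length P ℕ.≤ 3 → Outcome (1ℤ ∷ P)
classify⁺ (_ ∷ t0 ∷ []          , _ , _ , refl , ad≢0) _ = ⊥-elim (ad≢0 refl)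
classify⁺ (_ ∷ _ ∷ t0 ∷ []      , _ , _ , refl , ad≢0) _ = ⊥-elim (ad≢0 refl)
classify⁺ (_ ∷ _ ∷ _ ∷ t0 ∷ []  , _ , _ , refl , ad≢0) _ = ⊥-elim (ad≢0 refl)
classify⁺ (_ ∷ _ ∷ _ ∷ _ ∷ _ ∷ _ , _) (s≤s (s≤s (s≤s ())))
classify⁺ (t1 ∷ []                      , _) _ = newman-multiple (1ℤ ∷ [])
classify⁺ (ts@(t1 ∷ t-1 ∷ [])           , _) _ = root-between 0ℚ 1ℚ ts
classify⁺ (t1 ∷ t1 ∷ []                 , _) _ = newman-multiple (1ℤ ∷ [])
classify⁺ (ts@(t1 ∷ t-1 ∷ t-1 ∷ [])     , _) _ = root-between 0ℚ 1ℚ ts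
classify⁺ (t1 ∷ t-1 ∷ t1 ∷ []           , _) _ = newman-multiple (1ℤ ∷ 1ℤ ∷ [])
classify⁺ (ts@(t1 ∷ t0 ∷ t-1 ∷ [])      , _) _ = root-between 0ℚ 1ℚ ts
classify⁺ (t1 ∷ t0 ∷ t1 ∷ []            , _) _ = newman-multiple (1ℤ ∷ [])
classify⁺ (ts@(t1 ∷ t1 ∷ t-1 ∷ [])      , _) _ = root-between 1ℚ (+ 2 ℚ./ 1) ts
classify⁺ (t1 ∷ t1 ∷ t1 ∷ []            , _) _ = newman-multiple (1ℤ ∷ [])
classify⁺ (ts@(t1 ∷ t-1 ∷ t-1 ∷ t-1 ∷ []) , _) _ = root-between 0ℚ 1ℚ ts
classify⁺ (ts@(t1 ∷ t-1 ∷ t-1 ∷ t1 ∷ [])  , _) _ = root-between 0ℚ 1ℚ ts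
classify⁺ (ts@(t1 ∷ t-1 ∷ t0 ∷ t-1 ∷ [])  , _) _ = root-between 0ℚ 1ℚ ts
classify⁺ (t1 ∷ t-1 ∷ t0 ∷ t1 ∷ []        , _) _ = newman-multiple (1ℤ ∷ 1ℤ ∷ 1ℤ ∷ [])
classify⁺ (ts@(t1 ∷ t-1 ∷ t1 ∷ t-1 ∷ [])  , _) _ = root-between 0ℚ 1ℚ ts
classify⁺ (t1 ∷ t-1 ∷ t1 ∷ t1 ∷ []        , _) _ = exceptional (inj₁ refl)
classify⁺ (ts@(t1 ∷ t0 ∷ t-1 ∷ t-1 ∷ [])  , _) _ = root-between 0ℚ 1ℚ ts
classify⁺ (t1 ∷ t0 ∷ t-1 ∷ t1 ∷ []        , _) _ = newman-multiple (1ℤ ∷ 1ℤ ∷ 1ℤ ∷ [])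
classify⁺ (ts@(t1 ∷ t0 ∷ t0 ∷ t-1 ∷ [])   , _) _ = root-between 0ℚ 1ℚ ts
classify⁺ (t1 ∷ t0 ∷ t0 ∷ t1 ∷ []         , _) _ = newman-multiple (1ℤ ∷ [])
classify⁺ (ts@(t1 ∷ t0 ∷ t1 ∷ t-1 ∷ [])   , _) _ = root-between 1ℚ (+ 2 ℚ./ 1) ts
classify⁺ (t1 ∷ t0 ∷ t1 ∷ t1 ∷ []         , _) _ = newman-multiple (1ℤ ∷ [])
classify⁺ (ts@(t1 ∷ t1 ∷ t-1 ∷ t-1 ∷ [])  , _) _ = root-between 0ℚ 1ℚ ts
classify⁺ (t1 ∷ t1 ∷ t-1 ∷ t1 ∷ []        , _) _ = exceptional (inj₂ (inj₂ (inj₁ refl)))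
classify⁺ (ts@(t1 ∷ t1 ∷ t0 ∷ t-1 ∷ [])   , _) _ = root-between 1ℚ (+ 2 ℚ./ 1) ts
classify⁺ (t1 ∷ t1 ∷ t0 ∷ t1 ∷ []         , _) _ = newman-multiple (1ℤ ∷ [])
classify⁺ (ts@(t1 ∷ t1 ∷ t1 ∷ t-1 ∷ [])   , _) _ = root-between 1ℚ (+ 2 ℚ./ 1) ts
classify⁺ (t1 ∷ t1 ∷ t1 ∷ t1 ∷ []         , _) _ = newman-multiple (1ℤ ∷ [])

classify : ∀ P → Borwein P → DegAtMost 3 P → Outcome P
classify (a ∷ P) borwein@(t1 ∷ _ , _) (s≤s deg) = classify⁺ borwein deg
classify (a ∷ P) (t0 ∷ _ , a≢0 , _)   _         = ⊥-elim (a≢0 refl)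
classify (a ∷ P) borwein@(t-1 ∷ _ , _) (s≤s deg) =
  subst Outcome (negₚ-involutive (a ∷ P))
    (Outcome-negₚ _ (classify⁺ (Borwein-negₚ borwein) (subst (ℕ._≤ 3) (sym (length-map _ P)) deg)))

p-Borwein : Borwein pPoly
p-Borwein = (t1 ∷ t-1 ∷ t1 ∷ t1 ∷ []) , (λ ()) , _ , refl , (λ ())

p*-Borwein : Borwein pStar
p*-Borwein = (t1 ∷ t1 ∷ t-1 ∷ t1 ∷ []) , (λ ()) , _ , refl , (λ ())

Exceptional⇒counterexample : ∀ {P} → Exceptional P →
  Borwein P × DegAtMost 3 P × ¬ HasNonnegRealRoot P × ¬ DividesSomeNewman P
Exceptional⇒counterexample (inj₁ refl) =
  p-Borwein , ℕP.≤-refl , p-¬root ,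
  annihilates-mulY⇒¬DividesSomeNewman pPoly p-annihilates-mulY
Exceptional⇒counterexample (inj₂ (inj₁ refl)) =
  Borwein-negₚ p-Borwein , ℕP.≤-refl , p-¬root ∘ HasNonnegRealRoot-negₚ (negₚ pPoly) ,
  annihilates-mulY⇒¬DividesSomeNewman (negₚ pPoly) (annihilates-negₚ pPoly mulY p-annihilates-mulY)
Exceptional⇒counterexample (inj₂ (inj₂ (inj₁ refl))) =
  p*-Borwein , ℕP.≤-refl , p*-¬root ,
  annihilates-mulY⁻¹⇒¬DividesSomeNewman pStar p*-annihilates-mulY⁻¹
Exceptional⇒counterexample (inj₂ (inj₂ (inj₂ refl))) =
  Borwein-negₚ p*-Borwein , ℕP.≤-refl , p*-¬root ∘ HasNonnegRealRoot-negₚ (negₚ pStar) ,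
  annihilates-mulY⁻¹⇒¬DividesSomeNewman (negₚ pStar) (annihilates-negₚ pStar mulY⁻¹ p*-annihilates-mulY⁻¹)

Exceptional⇒¬DegAtMost2 : ∀ {P} → Exceptional P → ¬ DegAtMost 2 P
Exceptional⇒¬DegAtMost2 (inj₁ refl)               (s≤s (s≤s (s≤s ())))
Exceptional⇒¬DegAtMost2 (inj₂ (inj₁ refl))        (s≤s (s≤s (s≤s ())))
Exceptional⇒¬DegAtMost2 (inj₂ (inj₂ (inj₁ refl))) (s≤s (s≤s (s≤s ())))
Exceptional⇒¬DegAtMost2 (inj₂ (inj₂ (inj₂ refl))) (s≤s (s≤s (s≤s ())))

proposition2p3 :
    ((P : Poly) → Borwein P → DegAtMost 2 P → ¬ HasNonnegRealRoot P → DividesSomeNewman P)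
    × ((P : Poly) →
        (Borwein P × DegAtMost 3 P × ¬ HasNonnegRealRoot P × ¬ DividesSomeNewman P)
        ⇔ (P ≡ pPoly ⊎ P ≡ negₚ pPoly ⊎ P ≡ pStar ⊎ P ≡ negₚ pStar))
proposition2p3 = quadratic , λ P → mk⇔ (cubic P) Exceptional⇒counterexample
  where
  quadratic : (P : Poly) → Borwein P → DegAtMost 2 P → ¬ HasNonnegRealRoot P → DividesSomeNewman P
  quadratic P borwein deg ¬root with classify P borwein (ℕP.m≤n⇒m≤1+n deg)
  ... | inj₁ divides          = divides
  ... | inj₂ (inj₁ root)      = ⊥-elim (¬root root)
  ... | inj₂ (inj₂ exception) = ⊥-elim (Exceptional⇒¬DegAtMost2 exception deg)

  cubic : (P : Poly) → Borwein P × DegAtMost 3 P × ¬ HasNonnegRealRoot P × ¬ DividesSomeNewman P → Exceptional P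
  cubic P (borwein , deg , ¬root , ¬divides) with classify P borwein deg
  ... | inj₁ divides          = ⊥-elim (¬divides divides)
  ... | inj₂ (inj₁ root)      = ⊥-elim (¬root root)
  ... | inj₂ (inj₂ exception) = exception
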